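{- Let $d\ge 1$, $n\ge 1$ and $t\ge 1$ be integers. If the directed de Bruijn graph $\vec{\mathcal B}(d,n)$ has a $t$-identifying code, then every $t$-identifying code $S$ of $\vec{\mathcal B}(d,n)$ satisfies $|S|\ge d^{n-1}(d-1)$.
   Context: Let $\mathcal A_d=\{0,1,\dots,d-1\}$ and let $\mathcal A_d^n$ be the set of strings $x=x_1x_2\cdots x_n$ of length $n$ over $\mathcal A_d$. The directed de Bruijn graph $\vec{\mathcal B}(d,n)$ has vertex set $\mathcal A_d^n$ and an arc from $x_1x_2\cdots x_n$ to $y_1y_2\cdots y_n$ if and only if $x_2\cdots x_n=y_1\cdots y_{n-1}$ (in particular constant strings carry loops). $\vec d(u,v)$ denotes the length of a shortest directed walk from $u$ to $v$. The in-ball of radius $t$ is $B_t^-(v)=\{u:\vec d(u,v)\le t\}$ (it contains $v$). For $S\subseteq V$, let $\mathrm{ID}_S(v)=B_t^-(v)\cap S$. A $t$-identifying code is a set $S\subseteq V$ such that $\mathrm{ID}_S(v)\neq\emptyset$ for every vertex $v$ and $\mathrm{ID}_S(u)\ne\mathrm{ID}_S(v)$ for all distinct vertices $u,v$. -}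

module Defs where

open import Data.Nat using (ℕ; zero; suc; _≤_)
open import Data.Fin using (Fin)
open import Data.Vec using (Vec; _∷_; []; tail; init; _∷ʳ_)
open import Data.List using (List)
open import Data.List.Membership.Propositional using (_∈_)
open import Data.Product using (Σ; _×_; ∃; ∃-syntax)
open import Relation.Binary.PropositionalEquality using (_≡_)
open import Relation.Nullary using (¬_)

-- Vertices of the directed de Bruijn graph B(d,n): strings of length n over {0,…,d-1}.
-- We take n = suc m (n ≥ 1).
Vertex : ℕ → ℕ → Set
Vertex d m = Vec (Fin d) (suc m)

Arc : ∀ {d m} → Vertex d m → Vertex d m → Set
Arc x y = tail x ≡ init y

data Walk {d m : ℕ} : ℕ → Vertex d m → Vertex d m → Set where
  here  : ∀ {u} → Walk zero u u
  step  : ∀ {k u v w} → Arc u v → Walk k v w → Walk (suc k) u w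

-- u ∈ B_t^-(v)  iff  d(u,v) ≤ t  iff  there is a walk u ⇝ v of length ≤ t.
InBall : ∀ {d m} → ℕ → Vertex d m → Vertex d m → Set
InBall t v u = ∃[ k ] (k ≤ t × Walk k u v)

InID : ∀ {d m} → ℕ → List (Vertex d m) → Vertex d m → Vertex d m → Set
InID t S v w = w ∈ S × InBall t v w

SameID : ∀ {d m} → ℕ → List (Vertex d m) → Vertex d m → Vertex d m → Set
SameID t S u v = ∀ w → (InID t S u w → InID t S v w) × (InID t S v w → InID t S u w)

IsIdentifyingCode : ∀ {d m} → ℕ → List (Vertex d m) → Set
IsIdentifyingCode {d} {m} t S =
  (∀ (v : Vertex d m) → ∃[ w ] InID t S v w) ×
  (∀ (u v : Vertex d m) → ¬ u ≡ v → ¬ SameID t S u v)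

-- Call two vertices siblings when they differ at most in their last letter,
-- i.e. they are p ∷ʳ c and p ∷ʳ c' for a common prefix p of length m.
-- Siblings have exactly the same in-neighbours, so every walk of positive
-- length into one of them can be redirected into the other.  Hence, if two
-- distinct siblings both lie outside a code S, they have the same identifying
-- set ID_S, contradicting that S is identifying (this needs no assumption on
-- t).  So each of the d^m sibling classes, of size d, has at most one vertex
-- outside S, and S contains at least d^m (d - 1) vertices.

module Submission where

open import Defs
open import Data.Nat using (ℕ; suc; zero; _≤_; _*_; _^_; _∸_; _+_; s≤s; z≤n)
open import Data.Nat.Properties using (≤-trans; ≤-reflexive; +-mono-≤; ∸-monoˡ-≤; module ≤-Reasoning)
open import Data.List using (List; length; []; _∷_; map; filter; cartesianProductWith; allFin; _++_)
open import Data.List.Properties using (length-map; length-++; filter-++; filter-all; length-tabulate)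
open import Data.List.Relation.Unary.All as All using (All)
open import Data.List.Relation.Unary.Any using (here; there)
open import Data.List.Relation.Unary.AllPairs using ([]; _∷_)
open import Data.List.Relation.Unary.Unique.Propositional using (Unique)
import Data.List.Relation.Unary.Unique.Propositional.Properties as Unique
open import Data.List.Membership.Propositional using (_∈_; _∉_)
open import Data.List.Membership.Propositional.Properties using (∈-filter⁻; ∈-map⁻)
import Data.List.Membership.DecPropositional as DecMembership
open import Data.Fin using (Fin) renaming (_≟_ to _≟ᶠ_)
open import Data.Vec using (Vec; []; _∷_; init; _∷ʳ_)
open import Data.Vec.Properties using (≡-dec; ∷ʳ-injective; init-∷ʳ; ∷-injective)
open import Data.Product using (∃-syntax; _,_; proj₂)
open import Data.Sum using (_⊎_; inj₁; inj₂)
open import Data.Empty using (⊥-elim)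
open import Relation.Binary.PropositionalEquality using (_≡_; _≢_; refl; sym; trans; cong; cong₂)
open import Relation.Nullary using (¬_; yes; no)
open import Relation.Unary using (Decidable)

-- An arc u → v only constrains init v, so a walk of positive length into v
-- is also a walk into any v' with init v' = init v.
redirect-walk : ∀ {d m k} {u v v' : Vertex d m} →
                init v ≡ init v' → Walk (suc k) u v → Walk (suc k) u v'
redirect-walk same (step arc here)         = step (trans arc same) here
redirect-walk same (step arc (step a₂ w)) = step arc (redirect-walk same (step a₂ w))

ball-of-sibling : ∀ {d m t} {v v' w : Vertex d m} → init v ≡ init v' →
                  InBall t v w → w ≡ v ⊎ InBall t v' w
ball-of-sibling same (zero  , _   , here) = inj₁ refl
ball-of-sibling same (suc k , k≤t , walk) = inj₂ (suc k , k≤t , redirect-walk same walk)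

uncoded-siblings-same-ID : ∀ {d m t} (S : List (Vertex d m)) {v v' : Vertex d m} →
                           init v ≡ init v' → v ∉ S → v' ∉ S → SameID t S v v'
uncoded-siblings-same-ID S same v∉S v'∉S w = transfer same v∉S , transfer (sym same) v'∉S
  where
  transfer : ∀ {a b} → init a ≡ init b → a ∉ S → InID _ S a w → InID _ S b w
  transfer a~b a∉S (w∈S , w∈ball) with ball-of-sibling a~b w∈ball
  ... | inj₁ refl     = ⊥-elim (a∉S w∈S)
  ... | inj₂ w∈ball' = w∈S , w∈ball'

code-misses-one-sibling : ∀ {d m t} {S : List (Vertex d m)} → IsIdentifyingCode t S →
                          ∀ p {c c'} → p ∷ʳ c ∉ S → p ∷ʳ c' ∉ S → p ∷ʳ c ≡ p ∷ʳ c'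
code-misses-one-sibling {S = S} (_ , separates) p {c} {c'} c∉S c'∉S
  with ≡-dec _≟ᶠ_ (p ∷ʳ c) (p ∷ʳ c')
... | yes equal   = equal
... | no distinct = ⊥-elim (separates _ _ distinct
                      (uncoded-siblings-same-ID S same-init c∉S c'∉S))
  where
  same-init : init (p ∷ʳ c) ≡ init (p ∷ʳ c')
  same-init = trans (init-∷ʳ c p) (sym (init-∷ʳ c' p))

AtMostOneFails : ∀ {A : Set} → (A → Set) → List A → Set
AtMostOneFails {A} P xs = ∀ {x y : A} → x ∈ xs → y ∈ xs → ¬ P x → ¬ P y → x ≡ y

length-filter-almost-all : ∀ {A : Set} {P : A → Set} (P? : Decidable P) (xs : List A) →
                           Unique xs → AtMostOneFails P xs →
                           length xs ≤ suc (length (filter P? xs))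
length-filter-almost-all P? [] _ _ = z≤n
length-filter-almost-all {P = P} P? (x ∷ xs) (x∉xs ∷ unique) one with P? x
... | yes _  = s≤s (length-filter-almost-all P? xs unique (λ y z → one (there y) (there z)))
... | no ¬Px = s≤s (≤-reflexive (cong length (sym (filter-all P? rest-satisfies))))
  where
  -- every other element differs from x, so it cannot fail P as well
  rest-satisfies : All P xs
  rest-satisfies = All.tabulate λ {y} y∈xs → satisfies y∈xs (All.lookup x∉xs y∈xs)
    where
    satisfies : ∀ {y} → y ∈ xs → x ≢ y → P y
    satisfies {y} y∈xs x≢y with P? y
    ... | yes Py  = Py
    ... | no ¬Py = ⊥-elim (x≢y (one (here refl) (there y∈xs) ¬Px ¬Py))

remove : ∀ {A : Set} {x : A} (ys : List A) → x ∈ ys → List A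
remove (y ∷ ys) (here _)  = ys
remove (y ∷ ys) (there p) = y ∷ remove ys p

length-remove : ∀ {A : Set} {x : A} (ys : List A) (p : x ∈ ys) →
                suc (length (remove ys p)) ≡ length ys
length-remove (y ∷ ys) (here _)  = refl
length-remove (y ∷ ys) (there p) = cong suc (length-remove ys p)

∈-remove : ∀ {A : Set} {x z : A} (ys : List A) (p : x ∈ ys) →
           z ∈ ys → z ≢ x → z ∈ remove ys p
∈-remove (y ∷ ys) (here refl) (here refl) z≢x = ⊥-elim (z≢x refl)
∈-remove (y ∷ ys) (here _)    (there q)   z≢x = q
∈-remove (y ∷ ys) (there p)   (here e)    z≢x = here e
∈-remove (y ∷ ys) (there p)   (there q)   z≢x = there (∈-remove ys p q z≢x)

length-≤-when-⊆ : ∀ {A : Set} (xs ys : List A) → Unique xs →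
                  (∀ {z} → z ∈ xs → z ∈ ys) → length xs ≤ length ys
length-≤-when-⊆ []       ys _                _   = z≤n
length-≤-when-⊆ (x ∷ xs) ys (x∉xs ∷ unique) xs⊆ys = begin
  suc (length xs)                  ≤⟨ s≤s (length-≤-when-⊆ xs (remove ys x∈ys) unique xs⊆rest) ⟩
  suc (length (remove ys x∈ys))    ≡⟨ length-remove ys x∈ys ⟩
  length ys                        ∎
  where
  open ≤-Reasoning
  x∈ys : x ∈ ys
  x∈ys = xs⊆ys (here refl)
  xs⊆rest : ∀ {z} → z ∈ xs → z ∈ remove ys x∈ys
  xs⊆rest z∈xs = ∈-remove ys x∈ys (xs⊆ys (there z∈xs)) (λ z≡x → All.lookup x∉xs z∈xs (sym z≡x))

length-cartesianProductWith : ∀ {A B C : Set} (f : A → B → C) (xs : List A) (ys : List B) →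
                              length (cartesianProductWith f xs ys) ≡ length xs * length ys
length-cartesianProductWith f []       ys = refl
length-cartesianProductWith f (x ∷ xs) ys =
  trans (length-++ (map (f x) ys))
        (cong₂ _+_ (length-map (f x) ys) (length-cartesianProductWith f xs ys))

length-allFin : ∀ d → length (allFin d) ≡ d
length-allFin d = length-tabulate {n = d} (λ i → i)

module Enumeration (d : ℕ) where

  words : ∀ m → List (Vec (Fin d) m)
  words zero    = [] ∷ []
  words (suc m) = cartesianProductWith _∷_ (allFin d) (words m)

  length-words : ∀ m → length (words m) ≡ d ^ m
  length-words zero    = refl
  length-words (suc m) =
    trans (length-cartesianProductWith _∷_ (allFin d) (words m))
          (cong₂ _*_ (length-allFin d) (length-words m))

  siblings : ∀ {m} → Vec (Fin d) m → List (Vertex d m)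
  siblings p = map (p ∷ʳ_) (allFin d)

  -- All vertices of B(d, m+1), listed class by class; the class of p is a block.
  vertices : ∀ m → List (Vertex d m)
  vertices m = cartesianProductWith _∷ʳ_ (words m) (allFin d)

  unique-vertices : ∀ m → Unique (vertices m)
  unique-vertices m = Unique.cartesianProductWith⁺ _∷ʳ_ (λ {w} {x} e → ∷ʳ-injective w x e)
                                                   (unique-words m) (Unique.allFin⁺ d)
    where
    unique-words : ∀ m → Unique (words m)
    unique-words zero    = All.[] ∷ []
    unique-words (suc m) = Unique.cartesianProductWith⁺ _∷_ ∷-injective
                                                        (Unique.allFin⁺ d) (unique-words m)

  module _ {m : ℕ} {P : Vertex d m → Set} (P? : Decidable P)
           (one-per-class : ∀ p {c c'} → ¬ P (p ∷ʳ c) → ¬ P (p ∷ʳ c') → p ∷ʳ c ≡ p ∷ʳ c') where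

    class-bound : ∀ p → d ∸ 1 ≤ length (filter P? (siblings p))
    class-bound p = ∸-monoˡ-≤ 1 (begin
      d                                       ≡⟨ sym (trans (length-map (p ∷ʳ_) (allFin d)) (length-allFin d)) ⟩
      length (siblings p)                     ≤⟨ length-filter-almost-all P? (siblings p) unique one-fails ⟩
      suc (length (filter P? (siblings p)))   ∎)
      where
      open ≤-Reasoning
      unique : Unique (siblings p)
      unique = Unique.map⁺ (λ e → proj₂ (∷ʳ-injective p p e)) (Unique.allFin⁺ d)
      one-fails : AtMostOneFails P (siblings p)
      one-fails x∈ y∈ with ∈-map⁻ (p ∷ʳ_) x∈ | ∈-map⁻ (p ∷ʳ_) y∈
      ... | _ , _ , refl | _ , _ , refl = one-per-class p

    classes-bound : ∀ ps → length ps * (d ∸ 1) ≤ length (filter P? (cartesianProductWith _∷ʳ_ ps (allFin d)))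
    classes-bound []       = z≤n
    classes-bound (p ∷ ps) = begin
      d ∸ 1 + length ps * (d ∸ 1)
        ≤⟨ +-mono-≤ (class-bound p) (classes-bound ps) ⟩
      length (filter P? (siblings p)) + length (filter P? rest)
        ≡⟨ sym (length-++ (filter P? (siblings p))) ⟩
      length (filter P? (siblings p) ++ filter P? rest)
        ≡⟨ cong length (sym (filter-++ P? (siblings p) rest)) ⟩
      length (filter P? (siblings p ++ rest))
        ∎
      where
      open ≤-Reasoning
      rest = cartesianProductWith _∷ʳ_ ps (allFin d)

    vertices-bound : d ^ m * (d ∸ 1) ≤ length (filter P? (vertices m))
    vertices-bound = ≤-trans (≤-reflexive (cong (_* (d ∸ 1)) (sym (length-words m))))
                             (classes-bound (words m))

theorem3p8 : (d m t : ℕ) → 1 ≤ d → 1 ≤ t →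
    (∃[ C ] IsIdentifyingCode {d} {m} t C) →
    (S : List (Vertex d m)) → Unique S → IsIdentifyingCode t S →
    d ^ m * (d ∸ 1) ≤ length S
theorem3p8 d m t _ _ _ S _ S-identifying = begin
  d ^ m * (d ∸ 1)                       ≤⟨ vertices-bound (_∈? S) (code-misses-one-sibling S-identifying) ⟩
  length (filter (_∈? S) (vertices m))  ≤⟨ length-≤-when-⊆ _ S coded-unique coded⊆S ⟩
  length S                              ∎
  where
  open Enumeration d
  open ≤-Reasoning
  open DecMembership (≡-dec _≟ᶠ_) using (_∈?_)
  coded-unique : Unique (filter (_∈? S) (vertices m))
  coded-unique = Unique.filter⁺ (_∈? S) (unique-vertices m)
  coded⊆S : ∀ {v} → v ∈ filter (_∈? S) (vertices m) → v ∈ S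
  coded⊆S v∈ = proj₂ (∈-filter⁻ (_∈? S) {xs = vertices m} v∈)
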